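{- Let $K,\ell,t>0$ be integers and $0<\kappa\le1/2$. Let $\lambda=2\kappa$, $r=\lceil t/\kappa\rceil$ and $L=r\ell$. Let $\mathcal P=(A_1,\dots,A_K;B_1,\dots,B_L)$ be a parade in a bigraph $G$, of width $(W_1,W_2)$. Suppose there do not exist $1\le q_0<q_1<\dots<q_{2t}\le L$ and $X\subseteq A_1\cup\dots\cup A_K$ such that $X$ $2\kappa$-covers $B_{q_t}$ and $X$ $\kappa$-misses $B_{q_j}$ for all $j\in\{0,\dots,2t\}\setminus\{t\}$. For $1\le j\le\ell$ let $C_j$ be the union of the sets $B_i$ over all $i$ with $r(j-1)<i\le rj$. Then the parade $\mathcal C=(A_1,\dots,A_K;C_1,\dots,C_\ell)$ is $\lambda$-bottom-concave. Moreover, for every integer $\tau>0$, if $\mathcal P$ is $\tau$-support-uniform then: (i) $\mathcal C$ is $\tau$-support-uniform; (ii) for every ordered tree bigraph $T$ with $|V(T)|\le\tau$ and $|V_2(T)|\le\ell$, if the trace of $T$ relative to $\mathcal P$ is nonempty then the trace of $T$ relative to $\mathcal C$ is nonempty; and (iii) if in addition $\mathcal P$ is $(\kappa',\tau)$-support-invariant for some $\kappa'\ge\kappa$, then $\mathcal C$ is also $(\kappa',\tau)$-support-invariant.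
   Context: A bigraph $G$ is a finite simple graph with a designated bipartition $(V_1(G),V_2(G))$, all edges between the parts; isomorphisms of bigraphs map $V_i$ onto $V_i$. A tree bigraph is a bigraph whose underlying graph is a tree. A parade in $G$ is a sequence $(A_1,\dots,A_K;B_1,\dots,B_L)$ of pairwise disjoint nonempty subsets (blocks) of $V(G)$ with $A_i\subseteq V_1(G)$, $B_j\subseteq V_2(G)$, all $A_i$ of equal cardinality and all $B_j$ of equal cardinality; width $(|A_1|,|B_1|)$. A contraction replaces each block by a subset, keeping $A$-blocks of equal size and $B$-blocks of equal size. For $X\subseteq V_1(G)$, $Y\subseteq V_2(G)$ (or vice versa) and $0\le\mu\le1$: $X$ $\mu$-covers $Y$ if at least $\mu|Y|$ vertices of $Y$ have a neighbour in $X$; $X$ $\mu$-misses $Y$ if at least $\mu|Y|$ vertices of $Y$ have no neighbour in $X$. A parade $(A_1,\dots,A_K;B_1,\dots,B_L)$ is $\mu$-bottom-concave if there are no $X\subseteq A_1\cup\dots\cup A_K$ and $1\le h_1<h_2<h_3\le L$ with $X$ $\mu$-covering $B_{h_2}$ and $\mu$-missing $B_{h_1}$ and $B_{h_3}$. An induced sub-bigraph $H$ is $\mathcal P$-rainbow if each vertex lies in some block and no two in the same block; its support is $(I,J)$ with $I=\{i:V(H)\cap A_i\ne\emptyset\}$, $J=\{j:V(H)\cap B_j\ne\emptyset\}$. An ordered bigraph has linear orders on $V_1$ and $V_2$ (isomorphisms preserve them); a $\mathcal P$-rainbow $H$ is ordered by block index and is a $\mathcal P$-rainbow copy of an ordered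 bigraph $S$ if this ordered bigraph is isomorphic to $S$. The trace of $S$ relative to $\mathcal P$ is the set of supports of its $\mathcal P$-rainbow copies. $\mathcal P$ (of length $(K,L)$) is $\tau$-support-uniform if for every ordered tree bigraph $S$ with at most $\tau$ vertices the trace of $S$ is empty or is the set of all $(I,J)$ with $I\subseteq\{1,\dots,K\}$, $J\subseteq\{1,\dots,L\}$, $|I|=|V_1(S)|$, $|J|=|V_2(S)|$. $\mathcal P$ is $(\kappa',\tau)$-support-invariant if for every contraction $\mathcal P''$ of $\mathcal P$ whose blocks have size at least $\kappa'$ times the corresponding blocks of $\mathcal P$, and every ordered tree bigraph $S$ with at most $\tau$ vertices, the traces of $S$ relative to $\mathcal P''$ and $\mathcal P$ coincide.
   Formalization: The parameters κ and κ′ are rational numbers. -}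

module Defs where

open import Data.Nat as ℕ using (ℕ; zero; suc; _+_; _*_)
open import Data.Integer using (+_)
open import Data.Rational as ℚ using (ℚ; _/_)
open import Data.Fin as Fin using (Fin; toℕ)
open import Data.Fin.Subset using (Subset; _∈_; _⊆_; ∣_∣; Nonempty; ⋃)
open import Data.Bool using (Bool; true; false)
open import Data.List using (List; []; _∷_; _++_; [_]; length; map; filter; allFin)
open import Data.List.Relation.Unary.Unique.Propositional using (Unique)
open import Data.Product using (Σ; ∃; ∃-syntax; _×_; _,_)
open import Data.Sum using (_⊎_; inj₁; inj₂)
open import Data.Empty using (⊥)
open import Data.Unit using (⊤)
open import Relation.Nullary using (¬_)
open import Relation.Nullary.Decidable using (_×-dec_)
open import Relation.Binary.PropositionalEquality using (_≡_; _≢_)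
open import Function.Bundles using (_⇔_)

ℕ→ℚ : ℕ → ℚ
ℕ→ℚ n = + n / 1

-- Bigraphs: V₁ = Fin n₁, V₂ = Fin n₂, edges only between the parts.
-- An ordered bigraph is the same data, the linear orders on V₁, V₂
-- being the natural orders on Fin.

record Bigraph : Set where
  field
    n₁  : ℕ
    n₂  : ℕ
    adj : Fin n₁ → Fin n₂ → Bool
open Bigraph public

OrderedBigraph : Set
OrderedBigraph = Bigraph

Vtx : Bigraph → Set
Vtx S = Fin (n₁ S) ⊎ Fin (n₂ S)

Edge : (S : Bigraph) → Vtx S → Vtx S → Set
Edge S (inj₁ a) (inj₂ b) = adj S a b ≡ true
Edge S (inj₂ b) (inj₁ a) = adj S a b ≡ true
Edge S (inj₁ _) (inj₁ _) = ⊥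
Edge S (inj₂ _) (inj₂ _) = ⊥

AdjChain : (S : Bigraph) → List (Vtx S) → Set
AdjChain S []           = ⊤
AdjChain S (x ∷ [])     = ⊤
AdjChain S (x ∷ y ∷ zs) = Edge S x y × AdjChain S (y ∷ zs)

data Walk (S : Bigraph) : Vtx S → Vtx S → Set where
  here : ∀ {u} → Walk S u u
  step : ∀ {u w v} → Edge S u w → Walk S w v → Walk S u v

Connected : Bigraph → Set
Connected S = ∀ (u v : Vtx S) → Walk S u v

HasCycle : Bigraph → Set
HasCycle S = Σ (Vtx S) λ v → Σ (List (Vtx S)) λ vs →
  (2 ℕ.≤ length vs) × Unique (v ∷ vs) × AdjChain S (v ∷ vs ++ [ v ])

IsTree : Bigraph → Set
IsTree S = (1 ℕ.≤ n₁ S + n₂ S) × Connected S × ¬ HasCycle S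

record RawParade (G : Bigraph) (K L : ℕ) : Set where
  field
    A : Fin K → Subset (n₁ G)
    B : Fin L → Subset (n₂ G)
open RawParade public

DisjointSets : ∀ {n} → Subset n → Subset n → Set
DisjointSets p q = ∀ x → x ∈ p → x ∈ q → ⊥

record IsParade {G : Bigraph} {K L : ℕ} (P : RawParade G K L) : Set where
  field
    A-nonempty : ∀ i → Nonempty (A P i)
    B-nonempty : ∀ j → Nonempty (B P j)
    A-disjoint : ∀ i i′ → i ≢ i′ → DisjointSets (A P i) (A P i′)
    B-disjoint : ∀ j j′ → j ≢ j′ → DisjointSets (B P j) (B P j′)
    A-equal    : ∀ i i′ → ∣ A P i ∣ ≡ ∣ A P i′ ∣
    B-equal    : ∀ j j′ → ∣ B P j ∣ ≡ ∣ B P j′ ∣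

InUnionA : ∀ {G K L} → RawParade G K L → Subset (n₁ G) → Set
InUnionA P X = ∀ x → x ∈ X → ∃[ i ] x ∈ A P i

Covers : (G : Bigraph) → ℚ → Subset (n₁ G) → Subset (n₂ G) → Set
Covers G μ X Y = Σ (Subset (n₂ G)) λ Z → Z ⊆ Y ×
  (∀ y → y ∈ Z → ∃[ x ] (x ∈ X × adj G x y ≡ true)) ×
  (μ ℚ.* ℕ→ℚ ∣ Y ∣ ℚ.≤ ℕ→ℚ ∣ Z ∣)

Misses : (G : Bigraph) → ℚ → Subset (n₁ G) → Subset (n₂ G) → Set
Misses G μ X Y = Σ (Subset (n₂ G)) λ Z → Z ⊆ Y ×
  (∀ y → y ∈ Z → ∀ x → x ∈ X → adj G x y ≡ false) ×
  (μ ℚ.* ℕ→ℚ ∣ Y ∣ ℚ.≤ ℕ→ℚ ∣ Z ∣)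

BottomConcave : ∀ {G K L} → ℚ → RawParade G K L → Set
BottomConcave {G} {K} {L} μ P =
  ¬ (Σ (Subset (n₁ G)) λ X → InUnionA P X ×
      Σ (Fin L) λ h₁ → Σ (Fin L) λ h₂ → Σ (Fin L) λ h₃ →
        (h₁ Fin.< h₂) × (h₂ Fin.< h₃) ×
        Covers G μ X (B P h₂) × Misses G μ X (B P h₁) × Misses G μ X (B P h₃))

-- A P-rainbow copy of the ordered bigraph S is an induced sub-bigraph
-- H of G with one vertex in each of some blocks, ordered by block
-- index, isomorphic (as ordered bigraph) to S.  Since an order
-- isomorphism of finite linear orders is unique, such a copy is given
-- by vertex maps f₁, f₂ and strictly increasing block-index maps α, β
-- (vertex a of S sits in block A_{α a}, etc.), preserving adjacency
-- and non-adjacency.  Its support is (image α, image β).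

StrictlyIncreasing : ∀ {m n} → (Fin m → Fin n) → Set
StrictlyIncreasing f = ∀ a a′ → a Fin.< a′ → f a Fin.< f a′

record RainbowCopy {G : Bigraph} {K L : ℕ} (P : RawParade G K L)
                   (S : OrderedBigraph) : Set where
  field
    f₁ : Fin (n₁ S) → Fin (n₁ G)
    f₂ : Fin (n₂ S) → Fin (n₂ G)
    α  : Fin (n₁ S) → Fin K
    β  : Fin (n₂ S) → Fin L
    α-incr : StrictlyIncreasing α
    β-incr : StrictlyIncreasing β
    f₁∈ : ∀ a → f₁ a ∈ A P (α a)
    f₂∈ : ∀ b → f₂ b ∈ B P (β b)
    adj-pres : ∀ a b → adj G (f₁ a) (f₂ b) ≡ adj S a b
open RainbowCopy public

InTrace : ∀ {G K L} → RawParade G K L → OrderedBigraph →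
          Subset K → Subset L → Set
InTrace P S I J = Σ (RainbowCopy P S) λ c →
  (∀ i → i ∈ I ⇔ (∃[ a ] α c a ≡ i)) ×
  (∀ j → j ∈ J ⇔ (∃[ b ] β c b ≡ j))

TraceNonempty : ∀ {G K L} → RawParade G K L → OrderedBigraph → Set
TraceNonempty {K = K} {L} P S = Σ (Subset K) λ I → Σ (Subset L) λ J → InTrace P S I J

SupportUniform : ∀ {G K L} → ℕ → RawParade G K L → Set
SupportUniform {K = K} {L} τ P =
  ∀ (S : OrderedBigraph) → IsTree S → n₁ S + n₂ S ℕ.≤ τ →
    (∀ I J → ¬ InTrace P S I J) ⊎
    (∀ I J → InTrace P S I J ⇔ (∣ I ∣ ≡ n₁ S × ∣ J ∣ ≡ n₂ S))

IsContraction : ∀ {G K L} → ℚ → RawParade G K L → RawParade G K L → Set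
IsContraction κ′ P P″ = IsParade P″ ×
  (∀ i → A P″ i ⊆ A P i) × (∀ j → B P″ j ⊆ B P j) ×
  (∀ i → κ′ ℚ.* ℕ→ℚ ∣ A P i ∣ ℚ.≤ ℕ→ℚ ∣ A P″ i ∣) ×
  (∀ j → κ′ ℚ.* ℕ→ℚ ∣ B P j ∣ ℚ.≤ ℕ→ℚ ∣ B P″ j ∣)

SupportInvariant : ∀ {G K L} → ℚ → ℕ → RawParade G K L → Set
SupportInvariant {G} {K} {L} κ′ τ P =
  ∀ (P″ : RawParade G K L) → IsContraction κ′ P P″ →
  ∀ (S : OrderedBigraph) → IsTree S → n₁ S + n₂ S ℕ.≤ τ →
  ∀ I J → InTrace P″ S I J ⇔ InTrace P S I J

-- The coarsened parade C: C_j (0-based j) is the union of the B_i with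
-- r·j ≤ i < r·(j+1) (0-based i), i.e. r(j−1) < i ≤ rj in 1-based terms.

coarsen : ∀ {G K} (r ℓ : ℕ) → RawParade G K (r * ℓ) → RawParade G K ℓ
coarsen r ℓ P = record
  { A = A P
  ; B = λ j → ⋃ (map (B P)
        (filter (λ i → (r * toℕ j ℕ.≤? toℕ i) ×-dec (toℕ i ℕ.<? r * suc (toℕ j)))
                (allFin (r * ℓ))))
  }

-- Each block C_j of the coarsened parade is the disjoint union of r blocks of P of a common
-- size W. If X (κ+κ)-covers C_j then, by averaging, X (κ+κ)-covers one of these blocks. If X
-- (κ+κ)-misses C_j, call a block heavy when X κ-misses it: every block has at most W missed
-- vertices and a light one fewer than κW, so (κ+κ)rW ≤ #heavy·W + κrW and there are at least
-- rκ ≥ t heavy blocks. Hence a violation h₁ < h₂ < h₃ of bottom-concavity of C gives t κ-missed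
-- blocks inside C_{h₁}, a (κ+κ)-covered block inside C_{h₂} and t κ-missed blocks inside
-- C_{h₃}, which is the excluded pattern in P.
--
-- A rainbow copy in C becomes one in P by indexing each vertex by the block of P containing it,
-- and a copy in P whose B-blocks are the first blocks of their groups is a copy in C; so the
-- traces of C are empty or full together with those of P. For support-invariance, averaging
-- picks in each group a block that a κ′-contraction C″ of C meets in a κ′ fraction; trimming
-- all blocks of P to the least of these intersections, inside them where possible, gives a
-- κ′-contraction of P whose copies through the picked blocks are copies in C″.

module Submission where

open import Defs
open import Algebra.Bundles using (CommutativeRing)
import Algebra.Properties.Semiring.Sum as Sum
open import Data.Bool using (true; false; if_then_else_)
open import Data.Empty using (⊥; ⊥-elim)
open import Data.Fin as Fin using (Fin; toℕ; cast; combine; fromℕ<)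
import Data.Fin.Properties as Fin
open import Data.Fin.Subset using (Subset; _∈_; _∉_; _⊆_; ∣_∣; _∩_; ⁅_⁆; ⊤; ⋃; Nonempty) renaming (⊥ to ∅)
open import Data.Fin.Subset.Properties
  using ( _∈?_; ∉⊥; ∈⊤; x∈⁅x⁆; x∈⁅y⁆⇒x≡y; x∈p∩q⁺; x∈p∪q⁻; x∈p∪q⁺; p∩q⊆p; p∩q⊆q; s⊆s; ⊆-antisym
        ; ∩-zeroʳ; ∣⊥∣≡0; ∣⊤∣≡n; ∣⁅x⁆∣≡1; p⊆q⇒∣p∣≤∣q∣; ∣p∩q∣≤∣q∣)
import Data.Integer as ℤ
import Data.Integer.Properties as ℤ
open import Data.List as List using (List; allFin; filter)
import Data.List.Membership.Propositional as List
import Data.List.Membership.Propositional.Properties as List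
import Data.List.Relation.Unary.All as All
import Data.List.Relation.Unary.Any as Any
open import Data.Nat as N using (ℕ; zero; suc; _+_; _*_; _∸_; _≤_; _<_; z≤n; s≤s)
import Data.Nat.Coprimality as Coprime
import Data.Nat.Properties as N
open import Data.List.Extrema N.≤-totalOrder using (argmin; f[argmin]≤f[xs])
open import Data.Product using (Σ; ∃; ∃-syntax; _×_; _,_; proj₁; proj₂)
open import Data.Rational as Q using (ℚ; 0ℚ; 1ℚ; ½; toℚᵘ)
import Data.Rational.Properties as Q
import Data.Rational.Unnormalised as ℚᵘ
import Data.Rational.Unnormalised.Properties as ℚᵘ
open import Data.Sum using (_⊎_; inj₁; inj₂; [_,_])
open import Data.Vec using ([]; _∷_; here; there; tabulate)
import Data.Vec.Properties as Vec
open import Function using (_∘_; id)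
open import Function.Bundles using (_⇔_; mk⇔; Equivalence)
open import Function.Definitions using (Injective)
open import Relation.Binary using (Tri; tri<; tri≈; tri>)
open import Relation.Binary.PropositionalEquality hiding ([_])
open import Relation.Nullary using (¬_; Dec; yes; no; does; proof; contradiction)
open import Relation.Nullary.Decidable using (dec-true; _×-dec_)
open import Relation.Nullary.Reflects using (Reflects; invert)
open import Relation.Unary using (Pred; Decidable)

open Sum N.+-*-semiring using (sum; sum-syntax; sum-cong-≗; ∑-comm; *-distribʳ-sum)
module ℚΣ = Sum (CommutativeRing.semiring Q.+-*-commutativeRing)

toℚᵘ-ℕ→ℚ : ∀ n → toℚᵘ (ℕ→ℚ n) ≡ ℚᵘ.mkℚᵘ (ℤ.+ n) 0
toℚᵘ-ℕ→ℚ n = cong toℚᵘ (Q.normalize-coprime (Coprime.sym (Coprime.1-coprimeTo n)))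

ℕ→ℚ-+ : ∀ m n → ℕ→ℚ (m + n) ≡ ℕ→ℚ m Q.+ ℕ→ℚ n
ℕ→ℚ-+ m n = Q.toℚᵘ-injective (begin
  toℚᵘ (ℕ→ℚ (m + n))                        ≡⟨ toℚᵘ-ℕ→ℚ (m + n) ⟩
  ℚᵘ.mkℚᵘ (ℤ.+ (m + n)) 0                   ≡⟨ cong₂ (λ a b → ℚᵘ.mkℚᵘ (a ℤ.+ b) 0) (unit m) (unit n) ⟩
  ℚᵘ.mkℚᵘ (ℤ.+ m) 0 ℚᵘ.+ ℚᵘ.mkℚᵘ (ℤ.+ n) 0  ≡⟨ cong₂ ℚᵘ._+_ (toℚᵘ-ℕ→ℚ m) (toℚᵘ-ℕ→ℚ n) ⟨
  toℚᵘ (ℕ→ℚ m) ℚᵘ.+ toℚᵘ (ℕ→ℚ n)            ≈⟨ Q.toℚᵘ-homo-+ (ℕ→ℚ m) (ℕ→ℚ n) ⟨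
  toℚᵘ (ℕ→ℚ m Q.+ ℕ→ℚ n)                    ∎)
  where
  open ℚᵘ.≃-Reasoning
  unit : ∀ a → ℤ.+ a ≡ ℤ.+ a ℤ.* ℤ.+ 1
  unit a = sym (ℤ.*-identityʳ (ℤ.+ a))

ℕ→ℚ-* : ∀ m n → ℕ→ℚ (m * n) ≡ ℕ→ℚ m Q.* ℕ→ℚ n
ℕ→ℚ-* m n = Q.toℚᵘ-injective (begin
  toℚᵘ (ℕ→ℚ (m * n))                        ≡⟨ toℚᵘ-ℕ→ℚ (m * n) ⟩
  ℚᵘ.mkℚᵘ (ℤ.+ (m * n)) 0                   ≡⟨ cong (λ a → ℚᵘ.mkℚᵘ a 0) (ℤ.pos-* m n) ⟩
  ℚᵘ.mkℚᵘ (ℤ.+ m) 0 ℚᵘ.* ℚᵘ.mkℚᵘ (ℤ.+ n) 0  ≡⟨ cong₂ ℚᵘ._*_ (toℚᵘ-ℕ→ℚ m) (toℚᵘ-ℕ→ℚ n) ⟨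
  toℚᵘ (ℕ→ℚ m) ℚᵘ.* toℚᵘ (ℕ→ℚ n)            ≈⟨ Q.toℚᵘ-homo-* (ℕ→ℚ m) (ℕ→ℚ n) ⟨
  toℚᵘ (ℕ→ℚ m Q.* ℕ→ℚ n)                    ∎)
  where open ℚᵘ.≃-Reasoning

ℕ→ℚ-mono-≤ : ∀ {m n} → m ≤ n → ℕ→ℚ m Q.≤ ℕ→ℚ n
ℕ→ℚ-mono-≤ {m} {n} m≤n = Q.toℚᵘ-cancel-≤ (subst₂ ℚᵘ._≤_ (sym (toℚᵘ-ℕ→ℚ m)) (sym (toℚᵘ-ℕ→ℚ n))
  (ℚᵘ.*≤* (subst₂ ℤ._≤_ (sym (ℤ.*-identityʳ (ℤ.+ m))) (sym (ℤ.*-identityʳ (ℤ.+ n))) (ℤ.+≤+ m≤n))))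

ℕ→ℚ-cancel-≤ : ∀ {m n} → ℕ→ℚ m Q.≤ ℕ→ℚ n → m ≤ n
ℕ→ℚ-cancel-≤ {m} {n} p with subst₂ ℚᵘ._≤_ (toℚᵘ-ℕ→ℚ m) (toℚᵘ-ℕ→ℚ n) (Q.toℚᵘ-mono-≤ p)
... | ℚᵘ.*≤* m*1≤n*1 with subst₂ ℤ._≤_ (ℤ.*-identityʳ (ℤ.+ m)) (ℤ.*-identityʳ (ℤ.+ n)) m*1≤n*1
...   | ℤ.+≤+ m≤n = m≤n

ℕ→ℚ-cancel-< : ∀ {m n} → ℕ→ℚ m Q.< ℕ→ℚ n → m < n
ℕ→ℚ-cancel-< m<n = N.≰⇒> (λ n≤m → Q.<-irrefl refl (Q.<-≤-trans m<n (ℕ→ℚ-mono-≤ n≤m)))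

∑-mono-≤ : ∀ {n} {f g : Fin n → ℕ} → (∀ k → f k ≤ g k) → sum f ≤ sum g
∑-mono-≤ {zero}  f≤g = z≤n
∑-mono-≤ {suc n} f≤g = N.+-mono-≤ (f≤g Fin.zero) (∑-mono-≤ (f≤g ∘ Fin.suc))

∑-const : ∀ n c → ∑[ k < n ] c ≡ n * c
∑-const zero    c = refl
∑-const (suc n) c = cong (c +_) (∑-const n c)

fₖ≤∑f : ∀ {n} (f : Fin n → ℕ) k → f k ≤ sum f
fₖ≤∑f f Fin.zero    = N.m≤m+n _ _
fₖ≤∑f f (Fin.suc k) = N.m≤n⇒m≤o+n (f Fin.zero) (fₖ≤∑f (f ∘ Fin.suc) k)

χ : ∀ {n} → Subset n → Fin n → ℕ
χ p x = if does (x ∈? p) then 1 else 0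

χ-∈ : ∀ {n} {p : Subset n} {x} → x ∈ p → χ p x ≡ 1
χ-∈ {p = p} {x} x∈p with x ∈? p
... | yes _   = refl
... | no x∉p = contradiction x∈p x∉p

χ-∉ : ∀ {n} {p : Subset n} {x} → x ∉ p → χ p x ≡ 0
χ-∉ {p = p} {x} x∉p with x ∈? p
... | yes x∈p = contradiction x∈p x∉p
... | no _    = refl

χ-elim : ∀ {n} (p : Subset n) x {P : ℕ → Set} → (x ∈ p → P 1) → (x ∉ p → P 0) → P (χ p x)
χ-elim p x x∈p⇒ x∉p⇒ with x ∈? p
... | yes x∈p = x∈p⇒ x∈p
... | no x∉p  = x∉p⇒ x∉p

∣p∣≡∑χ : ∀ {n} (p : Subset n) → ∣ p ∣ ≡ ∑[ x < n ] χ p x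
∣p∣≡∑χ []          = refl
∣p∣≡∑χ (true ∷ p)  = cong suc (∣p∣≡∑χ p)
∣p∣≡∑χ (false ∷ p) = ∣p∣≡∑χ p

∑χ≡0 : ∀ {r n} (f : Fin r → Subset n) x → (∀ k → x ∉ f k) → ∑[ k < r ] χ (f k) x ≡ 0
∑χ≡0 {r} f x x∉f = trans (sum-cong-≗ (λ k → χ-∉ (x∉f k))) (trans (∑-const r 0) (N.*-zeroʳ r))

∑χ≤1 : ∀ {r n} (f : Fin r → Subset n) x → (∀ k k′ → x ∈ f k → x ∈ f k′ → k ≡ k′) →
       ∑[ k < r ] χ (f k) x ≤ 1
∑χ≤1 {zero}  f x unique = z≤n
∑χ≤1 {suc r} f x unique with x ∈? f Fin.zero
... | yes x∈f₀ =
  N.≤-reflexive (cong suc (∑χ≡0 (f ∘ Fin.suc) x λ k x∈fₖ → Fin.0≢1+n (unique _ _ x∈f₀ x∈fₖ)))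
... | no _     = ∑χ≤1 (f ∘ Fin.suc) x λ k k′ x∈fₖ x∈fₖ′ → Fin.suc-injective (unique _ _ x∈fₖ x∈fₖ′)

∣Z∣≤∑∣Z∩f∣ : ∀ {r n} (Z : Subset n) (f : Fin r → Subset n) →
             (∀ {x} → x ∈ Z → ∃ λ k → x ∈ f k) → ∣ Z ∣ ≤ ∑[ k < r ] ∣ Z ∩ f k ∣
∣Z∣≤∑∣Z∩f∣ {r} {n} Z f covered = begin
  ∣ Z ∣                                  ≡⟨ ∣p∣≡∑χ Z ⟩
  ∑[ x < n ] χ Z x                       ≤⟨ ∑-mono-≤ pointwise ⟩
  ∑[ x < n ] ∑[ k < r ] χ (Z ∩ f k) x    ≡⟨ ∑-comm (λ x k → χ (Z ∩ f k) x) ⟩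
  ∑[ k < r ] ∑[ x < n ] χ (Z ∩ f k) x    ≡⟨ sum-cong-≗ (λ k → ∣p∣≡∑χ (Z ∩ f k)) ⟨
  ∑[ k < r ] ∣ Z ∩ f k ∣                 ∎
  where
  open N.≤-Reasoning
  pointwise : ∀ x → χ Z x ≤ ∑[ k < r ] χ (Z ∩ f k) x
  pointwise x with x ∈? Z
  ... | no _    = z≤n
  ... | yes x∈Z = let k , x∈fₖ = covered x∈Z in
    subst (_≤ _) (χ-∈ (x∈p∩q⁺ (x∈Z , x∈fₖ))) (fₖ≤∑f (λ k → χ (Z ∩ f k) x) k)

∑∣f∣≤∣Y∣ : ∀ {r n} (Y : Subset n) (f : Fin r → Subset n) → (∀ k → f k ⊆ Y) →
           (∀ k k′ x → x ∈ f k → x ∈ f k′ → k ≡ k′) → ∑[ k < r ] ∣ f k ∣ ≤ ∣ Y ∣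
∑∣f∣≤∣Y∣ {r} {n} Y f f⊆Y disjoint = begin
  ∑[ k < r ] ∣ f k ∣                 ≡⟨ sum-cong-≗ (λ k → ∣p∣≡∑χ (f k)) ⟩
  ∑[ k < r ] ∑[ x < n ] χ (f k) x    ≡⟨ ∑-comm (λ k x → χ (f k) x) ⟩
  ∑[ x < n ] ∑[ k < r ] χ (f k) x    ≤⟨ ∑-mono-≤ pointwise ⟩
  ∑[ x < n ] χ Y x                   ≡⟨ ∣p∣≡∑χ Y ⟨
  ∣ Y ∣                              ∎
  where
  open N.≤-Reasoning
  pointwise : ∀ x → ∑[ k < r ] χ (f k) x ≤ χ Y x
  pointwise x with x ∈? Y
  ... | yes _   = ∑χ≤1 f x λ k k′ → disjoint k k′ x
  ... | no x∉Y = N.≤-reflexive (∑χ≡0 f x λ k x∈fₖ → x∉Y (f⊆Y k x∈fₖ))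

∣p∩⁅x⁆∣≡χ : ∀ {n} (p : Subset n) x → ∣ p ∩ ⁅ x ⁆ ∣ ≡ χ p x
∣p∩⁅x⁆∣≡χ {suc n} (true  ∷ p) Fin.zero = cong suc (trans (cong ∣_∣ (∩-zeroʳ p)) (∣⊥∣≡0 n))
∣p∩⁅x⁆∣≡χ {suc n} (false ∷ p) Fin.zero = trans (cong ∣_∣ (∩-zeroʳ p)) (∣⊥∣≡0 n)
∣p∩⁅x⁆∣≡χ (true  ∷ p) (Fin.suc x) = ∣p∩⁅x⁆∣≡χ p x
∣p∩⁅x⁆∣≡χ (false ∷ p) (Fin.suc x) = ∣p∩⁅x⁆∣≡χ p x

x∈⋃⁻ : ∀ {n} {A : Set} (f : A → Subset n) (is : List A) {x} → x ∈ ⋃ (List.map f is) →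
       ∃ λ i → i List.∈ is × x ∈ f i
x∈⋃⁻ f List.[]       x∈⋃ = contradiction x∈⋃ ∉⊥
x∈⋃⁻ f (i List.∷ is) x∈⋃ with x∈p∪q⁻ (f i) (⋃ (List.map f is)) x∈⋃
... | inj₁ x∈fᵢ = i , Any.here refl , x∈fᵢ
... | inj₂ x∈⋃′ = let j , j∈is , x∈fⱼ = x∈⋃⁻ f is x∈⋃′ in j , Any.there j∈is , x∈fⱼ

x∈⋃⁺ : ∀ {n} {A : Set} (f : A → Subset n) {is : List A} {i x} → i List.∈ is → x ∈ f i →
       x ∈ ⋃ (List.map f is)
x∈⋃⁺ f (Any.here refl)  x∈fᵢ = x∈p∪q⁺ (inj₁ x∈fᵢ)
x∈⋃⁺ f (Any.there i∈is) x∈fᵢ = x∈p∪q⁺ (inj₂ (x∈⋃⁺ f i∈is x∈fᵢ))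

image : ∀ {m n} → (Fin m → Fin n) → Subset m → Subset n
image g p = ⋃ (List.map (⁅_⁆ ∘ g) (filter (_∈? p) (allFin _)))

module _ {m n} (g : Fin m → Fin n) (p : Subset m) where

  ∈-image⁻ : ∀ {y} → y ∈ image g p → ∃ λ x → x ∈ p × g x ≡ y
  ∈-image⁻ y∈ = let x , x∈ , y∈⁅gx⁆ = x∈⋃⁻ (⁅_⁆ ∘ g) (filter (_∈? p) (allFin m)) y∈ in
    x , proj₂ (List.∈-filter⁻ (_∈? p) {xs = allFin m} x∈) , sym (x∈⁅y⁆⇒x≡y _ y∈⁅gx⁆)

  ∈-image⁺ : ∀ {x} → x ∈ p → g x ∈ image g p
  ∈-image⁺ {x} x∈p = x∈⋃⁺ (⁅_⁆ ∘ g) (List.∈-filter⁺ (_∈? p) (List.∈-allFin x) x∈p) (x∈⁅x⁆ (g x))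

  ∣image∣≡∣p∣ : Injective _≡_ _≡_ g → ∣ image g p ∣ ≡ ∣ p ∣
  ∣image∣≡∣p∣ g-inj = N.≤-antisym
    (begin
      ∣ image g p ∣                       ≤⟨ ∣Z∣≤∑∣Z∩f∣ (image g p) fibre covered ⟩
      ∑[ x < m ] ∣ image g p ∩ fibre x ∣  ≡⟨ ∑fibres ⟩
      ∣ p ∣                               ∎)
    (begin
      ∣ p ∣                               ≡⟨ ∑fibres ⟨
      ∑[ x < m ] ∣ image g p ∩ fibre x ∣  ≤⟨ ∑∣f∣≤∣Y∣ (image g p) (λ x → image g p ∩ fibre x) (λ x → p∩q⊆p _ _) disjoint ⟩
      ∣ image g p ∣                       ∎)
    where
    open N.≤-Reasoning
    fibre : Fin m → Subset n
    fibre = ⁅_⁆ ∘ g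
    covered : ∀ {y} → y ∈ image g p → ∃ λ x → y ∈ fibre x
    covered y∈ = let x , _ , gx≡y = ∈-image⁻ y∈ in x , subst (_∈ fibre x) gx≡y (x∈⁅x⁆ (g x))
    disjoint : ∀ x x′ y → y ∈ image g p ∩ fibre x → y ∈ image g p ∩ fibre x′ → x ≡ x′
    disjoint x x′ y y∈x y∈x′ =
      g-inj (trans (sym (x∈⁅y⁆⇒x≡y _ (p∩q⊆q _ _ y∈x))) (x∈⁅y⁆⇒x≡y _ (p∩q⊆q _ _ y∈x′)))
    χ-image : ∀ x → χ (image g p) (g x) ≡ χ p x
    χ-image x with x ∈? p
    ... | yes x∈p = χ-∈ (∈-image⁺ x∈p)
    ... | no x∉p  = χ-∉ λ gx∈ →
      let x′ , x′∈p , gx′≡gx = ∈-image⁻ gx∈ in x∉p (subst (_∈ p) (g-inj gx′≡gx) x′∈p)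
    ∑fibres : ∑[ x < m ] ∣ image g p ∩ fibre x ∣ ≡ ∣ p ∣
    ∑fibres = trans (sum-cong-≗ λ x → trans (∣p∩⁅x⁆∣≡χ _ (g x)) (χ-image x)) (sym (∣p∣≡∑χ p))

range : ∀ {m n} → (Fin m → Fin n) → Subset n
range g = image g ⊤

∈-range⇔ : ∀ {m n} (g : Fin m → Fin n) y → y ∈ range g ⇔ (∃ λ x → g x ≡ y)
∈-range⇔ g y = mk⇔ (λ y∈ → let x , _ , gx≡y = ∈-image⁻ g ⊤ y∈ in x , gx≡y)
                   (λ (x , gx≡y) → subst (_∈ range g) gx≡y (∈-image⁺ g ⊤ ∈⊤))

∣range∣≡m : ∀ {m n} (g : Fin m → Fin n) → Injective _≡_ _≡_ g → (J : Subset n) →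
           (∀ y → y ∈ J ⇔ (∃ λ x → g x ≡ y)) → ∣ J ∣ ≡ m
∣range∣≡m {m} g g-inj J J≡range = begin-equality
  ∣ J ∣           ≡⟨ cong ∣_∣ (⊆-antisym (λ {y} → from (∈-range⇔ g y) ∘ to (J≡range y))
                                         (λ {y} → from (J≡range y) ∘ to (∈-range⇔ g y))) ⟩
  ∣ range g ∣     ≡⟨ ∣image∣≡∣p∣ g ⊤ g-inj ⟩
  ∣ ⊤ {m} ∣       ≡⟨ ∣⊤∣≡n m ⟩
  m               ∎
  where
  open N.≤-Reasoning
  open Equivalence

Nonempty⇒∣p∣≥1 : ∀ {n} {p : Subset n} → Nonempty p → 1 ≤ ∣ p ∣
Nonempty⇒∣p∣≥1 (x , x∈p) =
  subst (_≤ _) (∣⁅x⁆∣≡1 x) (p⊆q⇒∣p∣≤∣q∣ λ y∈⁅x⁆ → subst (_∈ _) (sym (x∈⁅y⁆⇒x≡y x y∈⁅x⁆)) x∈p)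

∣p∣≥1⇒Nonempty : ∀ {n} (p : Subset n) → 1 ≤ ∣ p ∣ → Nonempty p
∣p∣≥1⇒Nonempty (true  ∷ p) _    = Fin.zero , here
∣p∣≥1⇒Nonempty (false ∷ p) 1≤∣p∣ = let x , x∈p = ∣p∣≥1⇒Nonempty p 1≤∣p∣ in Fin.suc x , there x∈p

subset-of-size : ∀ {n} (p : Subset n) s → s ≤ ∣ p ∣ → ∃ λ q → q ⊆ p × ∣ q ∣ ≡ s
subset-of-size {n} p zero _ = ∅ , (λ x∈∅ → contradiction x∈∅ ∉⊥) , ∣⊥∣≡0 n
subset-of-size (true ∷ p) (suc s) (s≤s s≤∣p∣) =
  let q , q⊆p , ∣q∣≡s = subset-of-size p s s≤∣p∣ in true ∷ q , s⊆s q⊆p , cong suc ∣q∣≡s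
subset-of-size (false ∷ p) (suc s) s≤∣p∣ =
  let q , q⊆p , ∣q∣≡s = subset-of-size p (suc s) s≤∣p∣ in false ∷ q , s⊆s q⊆p , ∣q∣≡s

enumerate : ∀ {n} (p : Subset n) → Σ (Fin ∣ p ∣ → Fin n) λ e → StrictlyIncreasing e × (∀ a → e a ∈ p)
enumerate [] = (λ ()) , (λ ()) , (λ ())
enumerate {suc n} (true ∷ p) with enumerate p
... | e , e-incr , e∈p = e′ , e′-incr , e′∈
  where
  e′ : Fin (suc ∣ p ∣) → Fin (suc n)
  e′ Fin.zero    = Fin.zero
  e′ (Fin.suc a) = Fin.suc (e a)
  e′-incr : StrictlyIncreasing e′
  e′-incr Fin.zero    (Fin.suc _) _         = s≤s z≤n
  e′-incr (Fin.suc a) (Fin.suc b) (s≤s a<b) = s≤s (e-incr a b a<b)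
  e′∈ : ∀ a → e′ a ∈ true ∷ p
  e′∈ Fin.zero    = here
  e′∈ (Fin.suc a) = there (e∈p a)
enumerate (false ∷ p) with enumerate p
... | e , e-incr , e∈p = Fin.suc ∘ e , (λ a b a<b → s≤s (e-incr a b a<b)) , there ∘ e∈p

increasing-in : ∀ {n t} (p : Subset n) → t ≤ ∣ p ∣ →
  Σ (Fin t → Fin n) λ e → StrictlyIncreasing e × (∀ a → e a ∈ p)
increasing-in {t = t} p t≤∣p∣ with enumerate p
... | e , e-incr , e∈p = e ∘ inject , (λ a b a<b → e-incr _ _ (inject-mono a b a<b)) , e∈p ∘ inject
  where
  inject : Fin t → Fin ∣ p ∣
  inject a = Fin.inject≤ a t≤∣p∣
  inject-mono : ∀ a b → a Fin.< b → inject a Fin.< inject b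
  inject-mono a b = subst₂ N._<_ (sym (Fin.toℕ-inject≤ a t≤∣p∣)) (sym (Fin.toℕ-inject≤ b t≤∣p∣))

select : ∀ {n ℓ} {P : Pred (Fin n) ℓ} → Decidable P → Subset n
select P? = tabulate (does ∘ P?)

module _ {n ℓ} {P : Pred (Fin n) ℓ} (P? : Decidable P) where

  ∈-select⁺ : ∀ {x} → P x → x ∈ select P?
  ∈-select⁺ {x} Px = Vec.lookup⇒[]= x _ (trans (Vec.lookup∘tabulate _ x) (dec-true (P? x) Px))

  ∈-select⁻ : ∀ {x} → x ∈ select P? → P x
  ∈-select⁻ {x} x∈ = invert (subst (Reflects (P x)) does≡true (proof (P? x)))
    where
    does≡true : does (P? x) ≡ true
    does≡true = trans (sym (Vec.lookup∘tabulate _ x)) (Vec.[]=⇒lookup x∈)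

ℕ→ℚ-∑ : ∀ {n} (f : Fin n → ℕ) → ℕ→ℚ (sum f) ≡ ℚΣ.sum (ℕ→ℚ ∘ f)
ℕ→ℚ-∑ {zero}  f = refl
ℕ→ℚ-∑ {suc n} f = trans (ℕ→ℚ-+ (f Fin.zero) _) (cong (ℕ→ℚ (f Fin.zero) Q.+_) (ℕ→ℚ-∑ (f ∘ Fin.suc)))

∑-mono-≤ℚ : ∀ {n} {f g : Fin n → ℚ} → (∀ k → f k Q.≤ g k) → ℚΣ.sum f Q.≤ ℚΣ.sum g
∑-mono-≤ℚ {zero}  f≤g = Q.≤-refl
∑-mono-≤ℚ {suc n} f≤g = Q.+-mono-≤ (f≤g Fin.zero) (∑-mono-≤ℚ (f≤g ∘ Fin.suc))

∑-mono-<ℚ : ∀ {n} {f g : Fin (suc n) → ℚ} → (∀ k → f k Q.< g k) → ℚΣ.sum f Q.< ℚΣ.sum g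
∑-mono-<ℚ f<g = Q.+-mono-<-≤ (f<g Fin.zero) (∑-mono-≤ℚ (Q.<⇒≤ ∘ f<g ∘ Fin.suc))

weighted-pigeonhole : ∀ {n} (μ : ℚ) (w z : Fin (suc n) → ℕ) →
  μ Q.* ℕ→ℚ (sum w) Q.≤ ℕ→ℚ (sum z) → ∃ λ k → μ Q.* ℕ→ℚ (w k) Q.≤ ℕ→ℚ (z k)
weighted-pigeonhole μ w z μw≤z with Fin.any? (λ k → μ Q.* ℕ→ℚ (w k) Q.≤? ℕ→ℚ (z k))
... | yes found = found
... | no none = ⊥-elim (Q.<-irrefl refl (Q.<-≤-trans (begin-strict
  ℕ→ℚ (sum z)                       ≡⟨ ℕ→ℚ-∑ z ⟩
  ℚΣ.sum (ℕ→ℚ ∘ z)                  <⟨ ∑-mono-<ℚ (λ k → Q.≰⇒> (λ μwₖ≤zₖ → none (k , μwₖ≤zₖ))) ⟩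
  ℚΣ.sum (λ k → μ Q.* ℕ→ℚ (w k))    ≡⟨ ℚΣ.*-distribˡ-sum μ (ℕ→ℚ ∘ w) ⟨
  μ Q.* ℚΣ.sum (ℕ→ℚ ∘ w)            ≡⟨ cong (μ Q.*_) (ℕ→ℚ-∑ w) ⟨
  μ Q.* ℕ→ℚ (sum w)                 ∎) μw≤z))
  where open Q.≤-Reasoning

-- Stated with 0 * w and 1 * w so that χ-elim can choose between them.
light-part-bound : ∀ κ w z → ℕ→ℚ z Q.< κ Q.* ℕ→ℚ w → ℕ→ℚ z Q.≤ ℕ→ℚ (0 * w) Q.+ κ Q.* ℕ→ℚ w
light-part-bound κ w z z<κw = Q.≤-trans (Q.<⇒≤ z<κw) (Q.≤-reflexive (sym (Q.+-identityˡ (κ Q.* ℕ→ℚ w))))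

heavy-part-bound : ∀ κ w z → 0ℚ Q.≤ κ → z ≤ w → ℕ→ℚ z Q.≤ ℕ→ℚ (1 * w) Q.+ κ Q.* ℕ→ℚ w
heavy-part-bound κ w z 0≤κ z≤w = Q.≤-trans (ℕ→ℚ-mono-≤ (subst (z ≤_) (sym (N.*-identityˡ w)) z≤w))
  (Q.≤-trans (Q.≤-reflexive (sym (Q.+-identityʳ (ℕ→ℚ (1 * w))))) (Q.+-monoʳ-≤ (ℕ→ℚ (1 * w)) 0≤κw))
  where
  0≤κw : 0ℚ Q.≤ κ Q.* ℕ→ℚ w
  0≤κw = subst (Q._≤ κ Q.* ℕ→ℚ w) (Q.*-zeroʳ κ)
    (Q.*-monoˡ-≤-nonNeg κ {{Q.nonNegative 0≤κ}} (ℕ→ℚ-mono-≤ (z≤n {w})))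

module _ {n} (κ : ℚ) (w z : Fin n → ℕ) where

  heavy? : Decidable (λ k → κ Q.* ℕ→ℚ (w k) Q.≤ ℕ→ℚ (z k))
  heavy? k = κ Q.* ℕ→ℚ (w k) Q.≤? ℕ→ℚ (z k)

  heavy : Subset n
  heavy = select heavy?

  heavy-weight : 0ℚ Q.≤ κ → (∀ k → z k ≤ w k) →
    (κ Q.+ κ) Q.* ℕ→ℚ (sum w) Q.≤ ℕ→ℚ (sum z) →
    κ Q.* ℕ→ℚ (sum w) Q.≤ ℕ→ℚ (sum (λ k → χ heavy k * w k))
  heavy-weight 0≤κ z≤w 2κw≤z = Q.≮⇒≥ λ H<κS → Q.<-irrefl refl (begin-strict
    H Q.+ κS                 <⟨ Q.+-mono-<-≤ H<κS Q.≤-refl ⟩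
    κS Q.+ κS                ≡⟨ Q.*-distribʳ-+ S κ κ ⟨
    (κ Q.+ κ) Q.* S          ≤⟨ 2κw≤z ⟩
    ℕ→ℚ (sum z)              ≤⟨ z≤H+κS ⟩
    H Q.+ κS                 ∎)
    where
    open Q.≤-Reasoning
    hw : Fin n → ℕ
    hw k = χ heavy k * w k
    S κS H : ℚ
    S  = ℕ→ℚ (sum w)
    κS = κ Q.* S
    H  = ℕ→ℚ (sum hw)
    pointwise : ∀ k → ℕ→ℚ (z k) Q.≤ ℕ→ℚ (χ heavy k * w k) Q.+ κ Q.* ℕ→ℚ (w k)
    pointwise k = χ-elim heavy k {P = λ c → ℕ→ℚ (z k) Q.≤ ℕ→ℚ (c * w k) Q.+ κ Q.* ℕ→ℚ (w k)}
      (λ _ → heavy-part-bound κ (w k) (z k) 0≤κ (z≤w k))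
      (λ k∉H → light-part-bound κ (w k) (z k) (Q.≰⇒> (k∉H ∘ ∈-select⁺ heavy?)))
    z≤H+κS : ℕ→ℚ (sum z) Q.≤ H Q.+ κS
    z≤H+κS = begin
      ℕ→ℚ (sum z)                                   ≡⟨ ℕ→ℚ-∑ z ⟩
      ℚΣ.sum (ℕ→ℚ ∘ z)                              ≤⟨ ∑-mono-≤ℚ pointwise ⟩
      ℚΣ.sum (λ k → ℕ→ℚ (hw k) Q.+ κ Q.* ℕ→ℚ (w k))  ≡⟨ ℚΣ.∑-distrib-+ (ℕ→ℚ ∘ hw) (λ k → κ Q.* ℕ→ℚ (w k)) ⟩
      ℚΣ.sum (ℕ→ℚ ∘ hw) Q.+ ℚΣ.sum (λ k → κ Q.* ℕ→ℚ (w k))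
                         ≡⟨ cong₂ Q._+_ (ℕ→ℚ-∑ hw) (ℚΣ.*-distribˡ-sum κ (ℕ→ℚ ∘ w)) ⟨
      H Q.+ κ Q.* ℚΣ.sum (ℕ→ℚ ∘ w)                  ≡⟨ cong (λ s → H Q.+ κ Q.* s) (ℕ→ℚ-∑ w) ⟨
      H Q.+ κS                                      ∎

module Blocks (r ℓ : ℕ) where

  index : Fin ℓ → Fin r → Fin (r * ℓ)
  index j k = cast (N.*-comm ℓ r) (combine j k)

  toℕ-index : ∀ j k → toℕ (index j k) ≡ r * toℕ j + toℕ k
  toℕ-index j k = trans (Fin.toℕ-cast _ (combine j k)) (Fin.toℕ-combine j k)

  index-monoˡ-< : ∀ {j j′} k k′ → j Fin.< j′ → index j k Fin.< index j′ k′
  index-monoˡ-< k k′ j<j′ =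
    subst₂ N._<_ (sym (Fin.toℕ-cast _ _)) (sym (Fin.toℕ-cast _ _)) (Fin.combine-monoˡ-< k k′ j<j′)

  index-monoʳ-< : ∀ j {k k′} → k Fin.< k′ → index j k Fin.< index j k′
  index-monoʳ-< j {k} {k′} k<k′ =
    subst₂ N._<_ (sym (toℕ-index j k)) (sym (toℕ-index j k′)) (N.+-monoʳ-< (r * toℕ j) k<k′)

  index-injective : ∀ j k j′ k′ → index j k ≡ index j′ k′ → j ≡ j′ × k ≡ k′
  index-injective j k j′ k′ eq = Fin.combine-injective j k j′ k′
    (Fin.toℕ-injective (trans (sym (Fin.toℕ-cast _ _)) (trans (cong toℕ eq) (Fin.toℕ-cast _ _))))

  InGroup : Fin ℓ → Fin (r * ℓ) → Set
  InGroup j i = r * toℕ j ≤ toℕ i × toℕ i < r * suc (toℕ j)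

  inGroup? : ∀ j → Decidable (InGroup j)
  inGroup? j i = (r * toℕ j N.≤? toℕ i) ×-dec (toℕ i N.<? r * suc (toℕ j))

  index-inGroup : ∀ j k → InGroup j (index j k)
  index-inGroup j k rewrite toℕ-index j k =
    N.m≤m+n _ _ ,
    subst (r * toℕ j + toℕ k <_) (sym (trans (N.*-suc r (toℕ j)) (N.+-comm r _))) (N.+-monoʳ-< (r * toℕ j) (Fin.toℕ<n k))

  inGroup-unique : ∀ {j j′ i} → InGroup j i → InGroup j′ i → j ≡ j′
  inGroup-unique {j} {j′} (lo , hi) (lo′ , hi′) = Fin.toℕ-injective (N.≤-antisym (below lo hi′) (below lo′ hi))
    where
    below : ∀ {a b i} → r * a ≤ i → i < r * suc b → a ≤ b
    below lo hi = N.s≤s⁻¹ (N.*-cancelˡ-< r _ _ (N.≤-<-trans lo hi))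

  inGroup⇒index : ∀ {j i} → InGroup j i → ∃ λ k → index j k ≡ i
  inGroup⇒index {j} {i} i∈j with Fin.combine-surjective {ℓ} {r} (cast (N.*-comm r ℓ) i)
  ... | j′ , k , eq =
    k , subst (λ j → index j k ≡ i) (inGroup-unique (subst (InGroup j′) index≡i (index-inGroup j′ k)) i∈j) index≡i
    where
    index≡i : index j′ k ≡ i
    index≡i = trans (cong (cast _) eq) (Fin.cast-involutive (N.*-comm ℓ r) (N.*-comm r ℓ) i)

module Splice {t L : ℕ} (E₁ E₃ : Fin t → Fin L) (m : Fin L)
  (E₁-incr : StrictlyIncreasing E₁) (E₃-incr : StrictlyIncreasing E₃)
  (E₁<m : ∀ a → E₁ a Fin.< m) (m<E₃ : ∀ a → m Fin.< E₃ a) where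

  private
    right : ∀ (j : Fin (1 + (t + t))) → t < toℕ j → toℕ j ∸ suc t < t
    right j t<j = N.+-cancelˡ-< (suc t) _ _ (begin-strict
      suc t + (toℕ j ∸ suc t)  ≡⟨ N.m+[n∸m]≡n t<j ⟩
      toℕ j                    <⟨ Fin.toℕ<n j ⟩
      suc (t + t)              ∎)
      where open N.≤-Reasoning

    pick : (j : Fin (1 + (t + t))) → Tri (toℕ j < t) (toℕ j ≡ t) (t < toℕ j) → Fin L
    pick j (tri< j<t _ _) = E₁ (Fin.fromℕ< j<t)
    pick j (tri≈ _ _ _)   = m
    pick j (tri> _ _ t<j) = E₃ (Fin.fromℕ< (right j t<j))

  spliced : Fin (1 + (t + t)) → Fin L
  spliced j = pick j (N.<-cmp (toℕ j) t)

  spliced-incr : StrictlyIncreasing spliced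
  spliced-incr j j′ j<j′ = pick-mono (N.<-cmp (toℕ j) t) (N.<-cmp (toℕ j′) t)
    where
    pick-mono : ∀ c c′ → pick j c Fin.< pick j′ c′
    pick-mono (tri< a _ _) (tri< a′ _ _) =
      E₁-incr _ _ (subst₂ N._<_ (sym (Fin.toℕ-fromℕ< a)) (sym (Fin.toℕ-fromℕ< a′)) j<j′)
    pick-mono (tri< _ _ _) (tri≈ _ _ _)  = E₁<m _
    pick-mono (tri< _ _ _) (tri> _ _ _)  = N.<-trans (E₁<m _) (m<E₃ _)
    pick-mono (tri≈ _ b _) (tri< a′ _ _) = contradiction (N.<-trans j<j′ a′) (N.<-irrefl b)
    pick-mono (tri≈ _ b _) (tri≈ _ b′ _) = contradiction j<j′ (N.<-irrefl (trans b (sym b′)))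
    pick-mono (tri≈ _ _ _) (tri> _ _ _)  = m<E₃ _
    pick-mono (tri> _ _ c) (tri< a′ _ _) = contradiction (N.<-trans c (N.<-trans j<j′ a′)) (N.<-irrefl refl)
    pick-mono (tri> _ _ c) (tri≈ _ b′ _) = contradiction (N.<-trans c j<j′) (N.<-irrefl (sym b′))
    pick-mono (tri> _ _ c) (tri> _ _ c′) =
      E₃-incr _ _ (subst₂ N._<_ (sym (Fin.toℕ-fromℕ< (right j c))) (sym (Fin.toℕ-fromℕ< (right j′ c′)))
                                (N.∸-monoˡ-< j<j′ c))

  spliced-mid : ∀ j → toℕ j ≡ t → spliced j ≡ m
  spliced-mid j j≡t with N.<-cmp (toℕ j) t
  ... | tri< _ j≢t _ = contradiction j≡t j≢t
  ... | tri≈ _ _ _   = refl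
  ... | tri> _ j≢t _ = contradiction j≡t j≢t

  spliced-side : ∀ j → toℕ j ≢ t → (∃ λ a → spliced j ≡ E₁ a) ⊎ (∃ λ a → spliced j ≡ E₃ a)
  spliced-side j j≢t with N.<-cmp (toℕ j) t
  ... | tri< _ _ _   = inj₁ (_ , refl)
  ... | tri≈ _ j≡t _ = contradiction j≡t j≢t
  ... | tri> _ _ _   = inj₂ (_ , refl)

module _ {m n} {f : Fin m → Fin n} (f-incr : StrictlyIncreasing f) where

  increasing-reflects-< : ∀ {a b} → f a Fin.< f b → a Fin.< b
  increasing-reflects-< {a} {b} fa<fb with Fin.<-cmp a b
  ... | tri< a<b _ _ = a<b
  ... | tri≈ _ refl _ = contradiction fa<fb (N.<-irrefl refl)
  ... | tri> _ _ b<a = contradiction fa<fb (N.<-asym (f-incr b a b<a))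

  increasing⇒injective : Injective _≡_ _≡_ f
  increasing⇒injective {a} {b} fa≡fb with Fin.<-cmp a b
  ... | tri< a<b _ _ = contradiction fa≡fb (N.<⇒≢ (f-incr a b a<b) ∘ cong toℕ)
  ... | tri≈ _ a≡b _ = a≡b
  ... | tri> _ _ b<a = contradiction (sym fa≡fb) (N.<⇒≢ (f-incr b a b<a) ∘ cong toℕ)

module _ {G : Bigraph} {K L : ℕ} {P : RawParade G K L} {S : OrderedBigraph} where

  support-card : ∀ {I J} → InTrace P S I J → ∣ I ∣ ≡ n₁ S × ∣ J ∣ ≡ n₂ S
  support-card (c , I≡range , J≡range) =
    ∣range∣≡m (α c) (increasing⇒injective (α-incr c)) _ I≡range ,
    ∣range∣≡m (β c) (increasing⇒injective (β-incr c)) _ J≡range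

module _ {G : Bigraph} {K L : ℕ} {P P″ : RawParade G K L} where

  trace-mono : (∀ i → A P″ i ⊆ A P i) → (∀ j → B P″ j ⊆ B P j) →
               ∀ {S I J} → InTrace P″ S I J → InTrace P S I J
  trace-mono A″⊆A B″⊆B {S} (c , supp) = copy , supp
    where
    copy : RainbowCopy P S
    copy = record
      { f₁ = f₁ c ; f₂ = f₂ c ; α = α c ; β = β c
      ; α-incr = α-incr c ; β-incr = β-incr c
      ; f₁∈ = λ a → A″⊆A (α c a) (f₁∈ c a)
      ; f₂∈ = λ b → B″⊆B (β c b) (f₂∈ c b)
      ; adj-pres = adj-pres c }

module _ {G : Bigraph} {K L ℓ : ℕ} {Q : RawParade G K L} {D : RawParade G K ℓ}
         (g : Fin ℓ → Fin L) (g-incr : StrictlyIncreasing g)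
         (A⊆ : ∀ i → A Q i ⊆ A D i) (B⊆ : ∀ j → B Q (g j) ⊆ B D j) where

  trace-pull : ∀ {S I J} → InTrace Q S I (image g J) → InTrace D S I J
  trace-pull {S} {I} {J} (c , I≡range , gJ≡range) = copy , I≡range , J≡range
    where
    preimage : ∀ b → ∃ λ j → j ∈ J × g j ≡ β c b
    preimage b = ∈-image⁻ g J (Equivalence.from (gJ≡range (β c b)) (b , refl))
    β′ : Fin (n₂ S) → Fin ℓ
    β′ = proj₁ ∘ preimage
    g∘β′ : ∀ b → g (β′ b) ≡ β c b
    g∘β′ b = proj₂ (proj₂ (preimage b))
    copy : RainbowCopy D S
    copy = record
      { f₁ = f₁ c ; f₂ = f₂ c ; α = α c ; β = β′
      ; α-incr = α-incr c
      ; β-incr = λ b b′ b<b′ → increasing-reflects-< g-incr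
          (subst₂ Fin._<_ (sym (g∘β′ b)) (sym (g∘β′ b′)) (β-incr c b b′ b<b′))
      ; f₁∈ = λ a → A⊆ (α c a) (f₁∈ c a)
      ; f₂∈ = λ b → B⊆ (β′ b) (subst (λ i → f₂ c b ∈ B Q i) (sym (g∘β′ b)) (f₂∈ c b))
      ; adj-pres = adj-pres c }
    J≡range : ∀ j → j ∈ J ⇔ (∃ λ b → β′ b ≡ j)
    J≡range j = mk⇔
      (λ j∈J → let b , βb≡gj = Equivalence.to (gJ≡range (g j)) (∈-image⁺ g J j∈J) in
        b , increasing⇒injective g-incr (trans (g∘β′ b) βb≡gj))
      (λ (b , β′b≡j) → subst (_∈ J) β′b≡j (proj₁ (proj₂ (preimage b))))

module _ {G : Bigraph} {μ : ℚ} {X : Subset (n₁ G)} {Z Y : Subset (n₂ G)} where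

  covers-within : (∀ y → y ∈ Z → ∃[ x ] (x ∈ X × adj G x y ≡ true)) →
                  μ Q.* ℕ→ℚ ∣ Y ∣ Q.≤ ℕ→ℚ ∣ Z ∩ Y ∣ → Covers G μ X Y
  covers-within Z-covered large = Z ∩ Y , p∩q⊆q Z Y , (λ y y∈ → Z-covered y (p∩q⊆p Z Y y∈)) , large

  misses-within : (∀ y → y ∈ Z → ∀ x → x ∈ X → adj G x y ≡ false) →
                  μ Q.* ℕ→ℚ ∣ Y ∣ Q.≤ ℕ→ℚ ∣ Z ∩ Y ∣ → Misses G μ X Y
  misses-within Z-missed large = Z ∩ Y , p∩q⊆q Z Y , (λ y y∈ → Z-missed y (p∩q⊆p Z Y y∈)) , large

TraceEmpty TraceFull : ∀ {G K L} → RawParade G K L → OrderedBigraph → Set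
TraceEmpty P S = ∀ I J → ¬ InTrace P S I J
TraceFull  P S = ∀ I J → InTrace P S I J ⇔ (∣ I ∣ ≡ n₁ S × ∣ J ∣ ≡ n₂ S)

module Coarsening {G : Bigraph} {K ℓ r′ : ℕ} (P : RawParade G K (suc r′ * ℓ)) (isP : IsParade P) where

  r : ℕ
  r = suc r′

  C : RawParade G K ℓ
  C = coarsen r ℓ P

  open Blocks r ℓ public
  open IsParade isP

  ∈C⁻ : ∀ {j x} → x ∈ B C j → ∃ λ k → x ∈ B P (index j k)
  ∈C⁻ {j} x∈ with x∈⋃⁻ (B P) (filter (inGroup? j) (allFin (r * ℓ))) x∈
  ... | i , i∈ , x∈Bᵢ with inGroup⇒index (proj₂ (List.∈-filter⁻ (inGroup? j) {xs = allFin (r * ℓ)} i∈))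
  ...   | k , index≡i = k , subst (λ i → _ ∈ B P i) (sym index≡i) x∈Bᵢ

  ∈C⁺ : ∀ {j k x} → x ∈ B P (index j k) → x ∈ B C j
  ∈C⁺ {j} {k} = x∈⋃⁺ (B P) (List.∈-filter⁺ (inGroup? j) (List.∈-allFin (index j k)) (index-inGroup j k))

  group-disjoint : ∀ j k k′ x → x ∈ B P (index j k) → x ∈ B P (index j k′) → k ≡ k′
  group-disjoint j k k′ x x∈ x∈′ with k Fin.≟ k′
  ... | yes k≡k′ = k≡k′
  ... | no k≢k′  = ⊥-elim (B-disjoint _ _ (k≢k′ ∘ proj₂ ∘ index-injective j k j k′) x x∈ x∈′)

  W : Fin ℓ → ℕ
  W j = ∣ B P (index j Fin.zero) ∣

  W≥1 : ∀ j → 1 ≤ W j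
  W≥1 j = Nonempty⇒∣p∣≥1 (B-nonempty (index j Fin.zero))

  ∣Bᵢ∣≡W : ∀ j i → ∣ B P i ∣ ≡ W j
  ∣Bᵢ∣≡W j i = B-equal i (index j Fin.zero)

  module _ (j : Fin ℓ) (Z : Subset (n₂ G)) where

    sizes parts : Fin r → ℕ
    sizes k = ∣ B P (index j k) ∣
    parts k = ∣ Z ∩ B P (index j k) ∣

    ∑sizes≡r*W : sum sizes ≡ r * W j
    ∑sizes≡r*W = trans (sum-cong-≗ (λ k → ∣Bᵢ∣≡W j (index j k))) (∑-const r (W j))

    fraction-spreads : ∀ {μ} → 0ℚ Q.≤ μ → Z ⊆ B C j → μ Q.* ℕ→ℚ ∣ B C j ∣ Q.≤ ℕ→ℚ ∣ Z ∣ →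
                       μ Q.* ℕ→ℚ (sum sizes) Q.≤ ℕ→ℚ (sum parts)
    fraction-spreads {μ} 0≤μ Z⊆Cⱼ large = begin
      μ Q.* ℕ→ℚ (sum sizes)  ≤⟨ Q.*-monoˡ-≤-nonNeg μ {{Q.nonNegative 0≤μ}} (ℕ→ℚ-mono-≤ packed) ⟩
      μ Q.* ℕ→ℚ ∣ B C j ∣    ≤⟨ large ⟩
      ℕ→ℚ ∣ Z ∣              ≤⟨ ℕ→ℚ-mono-≤ (∣Z∣≤∑∣Z∩f∣ Z (B P ∘ index j) (∈C⁻ ∘ Z⊆Cⱼ)) ⟩
      ℕ→ℚ (sum parts)        ∎
      where
      open Q.≤-Reasoning
      packed : sum sizes ≤ ∣ B C j ∣
      packed = ∑∣f∣≤∣Y∣ (B C j) (B P ∘ index j) (λ k → ∈C⁺) (group-disjoint j)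

    ∑χ*sizes≡ : (H : Subset r) → sum (λ k → χ H k * sizes k) ≡ ∣ H ∣ * W j
    ∑χ*sizes≡ H = begin
      sum (λ k → χ H k * sizes k)   ≡⟨ sum-cong-≗ (λ k → cong (χ H k *_) (∣Bᵢ∣≡W j (index j k))) ⟩
      sum (λ k → χ H k * W j)       ≡⟨ *-distribʳ-sum (W j) (χ H) ⟨
      sum (χ H) * W j               ≡⟨ cong (_* W j) (∣p∣≡∑χ H) ⟨
      ∣ H ∣ * W j                   ∎
      where open ≡-Reasoning

    heavy-part : ∀ {μ} → 0ℚ Q.≤ μ → Z ⊆ B C j → μ Q.* ℕ→ℚ ∣ B C j ∣ Q.≤ ℕ→ℚ ∣ Z ∣ →
                 ∃ λ k → μ Q.* ℕ→ℚ (sizes k) Q.≤ ℕ→ℚ (parts k)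
    heavy-part {μ} 0≤μ Z⊆Cⱼ large = weighted-pigeonhole μ sizes parts (fraction-spreads 0≤μ Z⊆Cⱼ large)

    many-heavy-parts : ∀ {κ t} → 0ℚ Q.≤ κ → ℕ→ℚ t Q.≤ ℕ→ℚ r Q.* κ → Z ⊆ B C j →
      (κ Q.+ κ) Q.* ℕ→ℚ ∣ B C j ∣ Q.≤ ℕ→ℚ ∣ Z ∣ → t ≤ ∣ heavy κ sizes parts ∣
    many-heavy-parts {κ} {t} 0≤κ t≤rκ Z⊆Cⱼ large =
      N.*-cancelʳ-≤ t ∣ H ∣ (W j) {{N.>-nonZero (W≥1 j)}} (ℕ→ℚ-cancel-≤ (begin
        ℕ→ℚ (t * W j)                               ≡⟨ ℕ→ℚ-* t (W j) ⟩
        ℕ→ℚ t Q.* ℕ→ℚ (W j)                         ≤⟨ Q.*-monoʳ-≤-nonNeg (ℕ→ℚ (W j)) {{0≤W}} t≤rκ ⟩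
        (ℕ→ℚ r Q.* κ) Q.* ℕ→ℚ (W j)                 ≡⟨ cong (Q._* ℕ→ℚ (W j)) (Q.*-comm (ℕ→ℚ r) κ) ⟩
        (κ Q.* ℕ→ℚ r) Q.* ℕ→ℚ (W j)                 ≡⟨ Q.*-assoc κ (ℕ→ℚ r) (ℕ→ℚ (W j)) ⟩
        κ Q.* (ℕ→ℚ r Q.* ℕ→ℚ (W j))                 ≡⟨ cong (κ Q.*_) (trans (cong ℕ→ℚ ∑sizes≡r*W) (ℕ→ℚ-* r (W j))) ⟨
        κ Q.* ℕ→ℚ (sum sizes)                       ≤⟨ heavy-weight κ sizes parts 0≤κ (λ _ → ∣p∩q∣≤∣q∣ Z _) 2κ-spread ⟩
        ℕ→ℚ (sum (λ k → χ H k * sizes k))           ≡⟨ cong ℕ→ℚ (∑χ*sizes≡ H) ⟩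
        ℕ→ℚ (∣ H ∣ * W j)                           ∎))
      where
      open Q.≤-Reasoning
      H : Subset r
      H = heavy κ sizes parts
      0≤W : Q.NonNegative (ℕ→ℚ (W j))
      0≤W = Q.nonNegative (ℕ→ℚ-mono-≤ (z≤n {W j}))
      2κ-spread : (κ Q.+ κ) Q.* ℕ→ℚ (sum sizes) Q.≤ ℕ→ℚ (sum parts)
      2κ-spread = fraction-spreads (Q.+-mono-≤ 0≤κ 0≤κ) Z⊆Cⱼ large

  covers-block : ∀ {μ X j} → 0ℚ Q.≤ μ → Covers G μ X (B C j) → ∃ λ k → Covers G μ X (B P (index j k))
  covers-block {μ} {j = j} 0≤μ (Z , Z⊆Cⱼ , Z-covered , large) =
    let k , heavyₖ = heavy-part j Z 0≤μ Z⊆Cⱼ large in k , covers-within {μ = μ} Z-covered heavyₖ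

  misses-blocks : ∀ {κ t X j} → 0ℚ Q.≤ κ → ℕ→ℚ t Q.≤ ℕ→ℚ r Q.* κ → Misses G (κ Q.+ κ) X (B C j) →
    Σ (Fin t → Fin r) λ e → StrictlyIncreasing e × (∀ a → Misses G κ X (B P (index j (e a))))
  misses-blocks {κ} {j = j} 0≤κ t≤rκ (Z , Z⊆Cⱼ , Z-missed , large) =
    let e , e-incr , e∈H = increasing-in (heavy κ (sizes j Z) (parts j Z)) (many-heavy-parts j Z 0≤κ t≤rκ Z⊆Cⱼ large) in
    e , e-incr , λ a → misses-within {μ = κ} Z-missed (∈-select⁻ (heavy? κ (sizes j Z) (parts j Z)) (e∈H a))

  bottom-concave : ∀ {κ t} → 0ℚ Q.< κ → ℕ→ℚ t Q.≤ ℕ→ℚ r Q.* κ →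
    ¬ (Σ (Fin (1 + (t + t)) → Fin (r * ℓ)) λ q → StrictlyIncreasing q ×
         Σ (Subset (n₁ G)) λ X → InUnionA P X ×
           (∀ j → toℕ j ≡ t → Covers G (κ Q.+ κ) X (B P (q j))) ×
           (∀ j → toℕ j ≢ t → Misses G κ X (B P (q j)))) →
    BottomConcave (κ Q.+ κ) C
  bottom-concave {κ} {t} 0<κ t≤rκ no-pattern
    (X , X⊆A , h₁ , h₂ , h₃ , h₁<h₂ , h₂<h₃ , covers₂ , misses₁ , misses₃) =
    forbidden (covers-block (Q.+-mono-≤ 0≤κ 0≤κ) covers₂)
              (misses-blocks 0≤κ t≤rκ misses₁) (misses-blocks 0≤κ t≤rκ misses₃)
    where
    0≤κ : 0ℚ Q.≤ κ
    0≤κ = Q.<⇒≤ 0<κ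
    forbidden : (∃ λ k → Covers G (κ Q.+ κ) X (B P (index h₂ k))) →
      (Σ (Fin t → Fin r) λ e → StrictlyIncreasing e × (∀ a → Misses G κ X (B P (index h₁ (e a))))) →
      (Σ (Fin t → Fin r) λ e → StrictlyIncreasing e × (∀ a → Misses G κ X (B P (index h₃ (e a))))) → ⊥
    forbidden (k₂ , covers-k₂) (e₁ , e₁-incr , misses-e₁) (e₃ , e₃-incr , misses-e₃) =
      no-pattern (spliced , spliced-incr , X , X⊆A , covers-middle , misses-sides)
      where
      open Splice (index h₁ ∘ e₁) (index h₃ ∘ e₃) (index h₂ k₂)
        (λ a b → index-monoʳ-< h₁ ∘ e₁-incr a b) (λ a b → index-monoʳ-< h₃ ∘ e₃-incr a b)
        (λ a → index-monoˡ-< (e₁ a) k₂ h₁<h₂) (λ a → index-monoˡ-< k₂ (e₃ a) h₂<h₃)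
      covers-middle : ∀ j → toℕ j ≡ t → Covers G (κ Q.+ κ) X (B P (spliced j))
      covers-middle j j≡t = subst (λ i → Covers G (κ Q.+ κ) X (B P i)) (sym (spliced-mid j j≡t)) covers-k₂
      misses-sides : ∀ j → toℕ j ≢ t → Misses G κ X (B P (spliced j))
      misses-sides j j≢t = [ (λ (a , eq) → subst (λ i → Misses G κ X (B P i)) (sym eq) (misses-e₁ a))
                           , (λ (a , eq) → subst (λ i → Misses G κ X (B P i)) (sym eq) (misses-e₃ a)) ] (spliced-side j j≢t)

  trace-refine : ∀ {S I J} → InTrace C S I J → ∃ λ J′ → InTrace P S I J′
  trace-refine {S} {I} (c , I≡range , _) = range β′ , copy , I≡range , ∈-range⇔ β′
    where
    block : ∀ b → ∃ λ k → f₂ c b ∈ B P (index (β c b) k)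
    block b = ∈C⁻ (f₂∈ c b)
    β′ : Fin (n₂ S) → Fin (r * ℓ)
    β′ b = index (β c b) (proj₁ (block b))
    copy : RainbowCopy P S
    copy = record
      { f₁ = f₁ c ; f₂ = f₂ c ; α = α c ; β = β′
      ; α-incr = α-incr c
      ; β-incr = λ b b′ b<b′ → index-monoˡ-< _ _ (β-incr c b b′ b<b′)
      ; f₁∈ = f₁∈ c
      ; f₂∈ = proj₂ ∘ block
      ; adj-pres = adj-pres c }

  section-incr : (c : Fin ℓ → Fin r) → StrictlyIncreasing (λ j → index j (c j))
  section-incr c j j′ = index-monoˡ-< (c j) (c j′)

  ∣image-section∣≡ : (c : Fin ℓ → Fin r) (J : Subset ℓ) → ∣ image (λ j → index j (c j)) J ∣ ≡ ∣ J ∣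
  ∣image-section∣≡ c J = ∣image∣≡∣p∣ _ J (increasing⇒injective (section-incr c))

  full-lifts : ∀ {S} → TraceFull P S → ∀ I J → ∣ I ∣ ≡ n₁ S → ∣ J ∣ ≡ n₂ S → InTrace C S I J
  full-lifts full I J ∣I∣≡ ∣J∣≡ = trace-pull first (section-incr (λ _ → Fin.zero)) (λ i → id) (λ j → ∈C⁺)
    (Equivalence.from (full I (image first J)) (∣I∣≡ , trans (∣image-section∣≡ _ J) ∣J∣≡))
    where
    first : Fin ℓ → Fin (r * ℓ)
    first j = index j Fin.zero

  uniform-coarsens : ∀ {S} → TraceEmpty P S ⊎ TraceFull P S → TraceEmpty C S ⊎ TraceFull C S
  uniform-coarsens (inj₁ empty) = inj₁ λ I J tr → let J′ , tr′ = trace-refine tr in empty I J′ tr′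
  uniform-coarsens (inj₂ full)  =
    inj₂ λ I J → mk⇔ support-card (λ (∣I∣≡ , ∣J∣≡) → full-lifts full I J ∣I∣≡ ∣J∣≡)

  trace-nonempty : ∀ {T} → TraceEmpty P T ⊎ TraceFull P T → n₂ T ≤ ℓ → TraceNonempty P T → TraceNonempty C T
  trace-nonempty (inj₁ empty) _ (I , J , tr) = ⊥-elim (empty I J tr)
  trace-nonempty {T} (inj₂ full) n₂≤ℓ (I , J , tr) =
    let J′ , _ , ∣J′∣≡ = subset-of-size ⊤ (n₂ T) (subst (n₂ T ≤_) (sym (∣⊤∣≡n ℓ)) n₂≤ℓ) in
    I , J′ , full-lifts full I J′ (proj₁ (support-card tr)) ∣J′∣≡

  module Shrinking {κ′ : ℚ} (0<κ′ : 0ℚ Q.< κ′) (j₀ : Fin ℓ)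
                   (P″ : RawParade G K ℓ) (contr : IsContraction κ′ C P″) where

    private
      isP″ : IsParade P″
      isP″ = proj₁ contr
      B″⊆C : ∀ j → B P″ j ⊆ B C j
      B″⊆C = proj₁ (proj₂ (proj₂ contr))
      A″-large : ∀ i → κ′ Q.* ℕ→ℚ ∣ A C i ∣ Q.≤ ℕ→ℚ ∣ A P″ i ∣
      A″-large = proj₁ (proj₂ (proj₂ (proj₂ contr)))
      B″-large : ∀ j → κ′ Q.* ℕ→ℚ ∣ B C j ∣ Q.≤ ℕ→ℚ ∣ B P″ j ∣
      B″-large = proj₂ (proj₂ (proj₂ (proj₂ contr)))

    chosen : Fin ℓ → Fin r
    chosen j = proj₁ (heavy-part j (B P″ j) (Q.<⇒≤ 0<κ′) (B″⊆C j) (B″-large j))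

    section : Fin ℓ → Fin (r * ℓ)
    section j = index j (chosen j)

    shared : Fin ℓ → ℕ
    shared j = ∣ B P″ j ∩ B P (section j) ∣

    heavy-chosen : ∀ j → κ′ Q.* ℕ→ℚ ∣ B P (section j) ∣ Q.≤ ℕ→ℚ (shared j)
    heavy-chosen j = proj₂ (heavy-part j (B P″ j) (Q.<⇒≤ 0<κ′) (B″⊆C j) (B″-large j))

    j⋆ : Fin ℓ
    j⋆ = argmin shared j₀ (allFin ℓ)

    s : ℕ
    s = shared j⋆

    s≤shared : ∀ j → s ≤ shared j
    s≤shared j = All.lookup (f[argmin]≤f[xs] {f = shared} j₀ (allFin ℓ)) (List.∈-allFin j)

    κ′∣Bᵢ∣≤s : ∀ i → κ′ Q.* ℕ→ℚ ∣ B P i ∣ Q.≤ ℕ→ℚ s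
    κ′∣Bᵢ∣≤s i = subst (λ w → κ′ Q.* ℕ→ℚ w Q.≤ ℕ→ℚ s) (B-equal (section j⋆) i) (heavy-chosen j⋆)

    s≥1 : 1 ≤ s
    s≥1 = ℕ→ℚ-cancel-< (Q.<-≤-trans 0<κ′∣B∣ (κ′∣Bᵢ∣≤s (section j₀)))
      where
      0<κ′∣B∣ : 0ℚ Q.< κ′ Q.* ℕ→ℚ ∣ B P (section j₀) ∣
      0<κ′∣B∣ = subst (Q._< κ′ Q.* ℕ→ℚ ∣ B P (section j₀) ∣) (Q.*-zeroʳ κ′)
        (Q.*-monoʳ-<-pos κ′ {{Q.positive 0<κ′}} {0ℚ} {ℕ→ℚ ∣ B P (section j₀) ∣}
          (Q.<-≤-trans (Q.positive⁻¹ 1ℚ) (ℕ→ℚ-mono-≤ (Nonempty⇒∣p∣≥1 (B-nonempty (section j₀))))))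

    Shrinkage : Fin (r * ℓ) → Set
    Shrinkage i = Σ (Subset (n₂ G)) λ q → q ⊆ B P i × ∣ q ∣ ≡ s × (∀ j → section j ≡ i → q ⊆ B P″ j)

    shrink : ∀ i → Dec (∃ λ j → section j ≡ i) → Shrinkage i
    shrink i (yes (j , refl)) =
      let q , q⊆ , ∣q∣≡s = subset-of-size (B P″ j ∩ B P (section j)) s (s≤shared j) in
      q , p∩q⊆q (B P″ j) (B P (section j)) ∘ q⊆ , ∣q∣≡s ,
      λ j′ eq → subst (λ j → q ⊆ B P″ j) (increasing⇒injective (section-incr chosen) (sym eq))
                      (p∩q⊆p (B P″ j) (B P (section j)) ∘ q⊆)
    shrink i (no not-chosen) =
      let q , q⊆ , ∣q∣≡s = subset-of-size (B P i) s s≤∣Bᵢ∣ in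
      q , q⊆ , ∣q∣≡s , λ j eq → contradiction (j , eq) not-chosen
      where
      s≤∣Bᵢ∣ : s ≤ ∣ B P i ∣
      s≤∣Bᵢ∣ = N.≤-trans (s≤shared j₀)
        (N.≤-trans (∣p∩q∣≤∣q∣ (B P″ j₀) (B P (section j₀))) (N.≤-reflexive (B-equal (section j₀) i)))

    shrunk : ∀ i → Shrinkage i
    shrunk i = shrink i (Fin.any? (λ j → section j Fin.≟ i))

    P′ : RawParade G K (r * ℓ)
    P′ = record { A = A P″ ; B = proj₁ ∘ shrunk }

    P′-contraction : IsContraction κ′ P P′
    P′-contraction = isP′ , proj₁ (proj₂ contr) , (proj₁ ∘ proj₂ ∘ shrunk) , A″-large ,
      λ i → subst (λ n → κ′ Q.* ℕ→ℚ ∣ B P i ∣ Q.≤ ℕ→ℚ n) (sym (∣B′ᵢ∣≡s i)) (κ′∣Bᵢ∣≤s i)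
      where
      ∣B′ᵢ∣≡s : ∀ i → ∣ B P′ i ∣ ≡ s
      ∣B′ᵢ∣≡s = proj₁ ∘ proj₂ ∘ proj₂ ∘ shrunk
      isP′ : IsParade P′
      isP′ = record
        { A-nonempty = IsParade.A-nonempty isP″
        ; B-nonempty = λ i → ∣p∣≥1⇒Nonempty _ (subst (1 ≤_) (sym (∣B′ᵢ∣≡s i)) s≥1)
        ; A-disjoint = IsParade.A-disjoint isP″
        ; B-disjoint = λ i i′ i≢i′ x x∈ x∈′ →
            B-disjoint i i′ i≢i′ x (proj₁ (proj₂ (shrunk i)) x∈) (proj₁ (proj₂ (shrunk i′)) x∈′)
        ; A-equal = IsParade.A-equal isP″
        ; B-equal = λ i i′ → trans (∣B′ᵢ∣≡s i) (sym (∣B′ᵢ∣≡s i′))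
        }

    trace-restore : ∀ {S I J} → InTrace P′ S I (image section J) → InTrace P″ S I J
    trace-restore = trace-pull section (section-incr chosen) (λ i → id)
      (λ j → proj₂ (proj₂ (proj₂ (shrunk (section j)))) j refl)

  support-invariant : ∀ {κ κ′ τ} → 0ℚ Q.< κ → κ Q.≤ κ′ → Fin ℓ → SupportUniform τ P →
                      SupportInvariant κ′ τ P → SupportInvariant κ′ τ C
  support-invariant 0<κ κ≤κ′ j₀ uniform invariant P″ contr S tree size I J =
    mk⇔ (trace-mono (proj₁ (proj₂ contr)) (proj₁ (proj₂ (proj₂ contr)))) (restore (uniform S tree size))
    where
    open Shrinking (Q.<-≤-trans 0<κ κ≤κ′) j₀ P″ contr
    restore : TraceEmpty P S ⊎ TraceFull P S → InTrace C S I J → InTrace P″ S I J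
    restore (inj₁ empty) tr = let J′ , tr′ = trace-refine tr in ⊥-elim (empty I J′ tr′)
    restore (inj₂ full)  tr =
      trace-restore (Equivalence.from (invariant P′ P′-contraction S tree size I (image section J))
        (Equivalence.from (full I (image section J))
          (proj₁ (support-card tr) , trans (∣image-section∣≡ chosen J) (proj₂ (support-card tr)))))

mainTheorem10 :
    (K ℓ t : ℕ) → 1 N.≤ K → 1 N.≤ ℓ → 1 N.≤ t →
    (κ : ℚ) → 0ℚ Q.< κ → κ Q.≤ ½ →
    (r : ℕ) → ℕ→ℚ t Q.≤ ℕ→ℚ r Q.* κ →
    ℕ→ℚ r Q.* κ Q.< ℕ→ℚ t Q.+ κ →
    (G : Bigraph) (P : RawParade G K (r * ℓ)) → IsParade P →
    ¬ (Σ (Fin (1 + (t + t)) → Fin (r * ℓ)) λ q →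
         StrictlyIncreasing q ×
         Σ (Subset (n₁ G)) λ X → InUnionA P X ×
           (∀ j → toℕ j ≡ t → Covers G (κ Q.+ κ) X (B P (q j))) ×
           (∀ j → toℕ j ≢ t → Misses G κ X (B P (q j)))) →
    BottomConcave (κ Q.+ κ) (coarsen r ℓ P) ×
    (∀ (τ : ℕ) → 1 N.≤ τ → SupportUniform τ P →
      SupportUniform τ (coarsen r ℓ P) ×
      (∀ (T : OrderedBigraph) → IsTree T → n₁ T + n₂ T N.≤ τ →
         n₂ T N.≤ ℓ → TraceNonempty P T → TraceNonempty (coarsen r ℓ P) T) ×
      (∀ (κ′ : ℚ) → κ Q.≤ κ′ → SupportInvariant κ′ τ P →
         SupportInvariant κ′ τ (coarsen r ℓ P)))
mainTheorem10 _ _ t _ _ t≥1 κ _ _ zero t≤rκ _ _ _ _ _ =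
  ⊥-elim (N.≤⇒≯ (ℕ→ℚ-cancel-≤ {t} {0} (subst (ℕ→ℚ t Q.≤_) (Q.*-zeroˡ κ) t≤rκ)) t≥1)
mainTheorem10 _ ℓ t _ ℓ≥1 _ κ 0<κ _ (suc r′) t≤rκ _ _ P isP no-pattern =
  bottom-concave 0<κ t≤rκ no-pattern ,
  λ τ _ uniform →
    (λ S tree size → uniform-coarsens (uniform S tree size)) ,
    (λ T tree size → trace-nonempty (uniform T tree size)) ,
    (λ κ′ κ≤κ′ → support-invariant 0<κ κ≤κ′ (fromℕ< ℓ≥1) uniform)
  where open Coarsening {ℓ = ℓ} {r′ = r′} P isP
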